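{- For every $r\ge n$, $\widetilde m_r(x\|a)$ lies in the kernel of $\epsilon_{\mathrm{Gr}}$.
   Context: Fix $n\ge2$. $\widetilde S_n$ is the group of bijections $w:\mathbb Z\to\mathbb Z$ with $w(i+n)=w(i)+n$ and $\sum_{i=1}^nw(i)=\sum_{i=1}^ni$. $\mathbb Q[a]=\mathbb Q[a_i:i\in\mathbb Z]$, $S=\mathbb Q[a_1,\dots,a_n]$, a $\mathbb Q[a]$-algebra via $a_{i+kn}\mapsto a_i$ ($1\le i\le n$, $k\in\mathbb Z$). $\Lambda(x\|a)$ is the polynomial algebra over $\mathbb Q[a]$ in algebraically independent generators $p_r[x-a]$ ($r\ge1$). For $r\ge1$, $\widetilde m_r(x\|a)=\sum_{j=1}^r(-1)^{r-j}e_{r-j}(a_1,a_0,a_{ -1},\dots,a_{2-r})\,p_j[x-a]$, with $e_m$ the elementary symmetric polynomial. For $w\in\widetilde S_n$, $\epsilon_w:\Lambda(x\|a)\to\mathbb Q[a]$ is the $\mathbb Q[a]$-algebra homomorphism with $\epsilon_w(p_r[x-a])=\sum_{i\in\mathbb Z_{\le0}\cap(1-w(\mathbb Z_{\le0}))}a_i^r-\sum_{i\in\mathbb Z_{>0}\setminus(1-w(\mathbb Z_{\le0}))}a_i^r$, where $1-w(\mathbb Z_{\le0})=\{1-w(j):j\le0\}$; $\epsilon_{\mathrm{Gr}}:\Lambda(x\|a)\to\mathrm{Fun}(\widetilde S_n,S)$ sends $f$ to $w\mapsto$ (image of $\epsilon_w(f)$ in $S$). -}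

module Defs where

open import Data.Nat as ℕ using (ℕ; zero; suc; NonZero)
open import Data.Integer as ℤ using (ℤ; +_; 0ℤ; 1ℤ)
import Data.Integer.Properties as ℤP
open import Data.Integer.Tactic.RingSolver using (solve-∀)
open import Data.List using (List; []; _∷_; map; upTo; filter; foldr)
open import Data.Product using (Σ; ∃-syntax; _×_; _,_)
open import Relation.Nullary using (Dec; yes; no; ¬_; ¬?; _×-dec_)
open import Relation.Binary.PropositionalEquality using (_≡_; refl; sym; trans; cong; subst)
open import Algebra.Bundles using (CommutativeRing)
open import Level using (Level)

sumℤ : List ℤ → ℤ
sumℤ = foldr ℤ._+_ 0ℤ

window : ℕ → List ℤ
window n = map (λ k → + suc k) (upTo n)

record AffPerm (n : ℕ) : Set where
  field
    fun      : ℤ → ℤ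
    inv      : ℤ → ℤ
    inv-fun  : ∀ i → inv (fun i) ≡ i
    fun-inv  : ∀ i → fun (inv i) ≡ i
    periodic : ∀ i → fun (i ℤ.+ + n) ≡ fun i ℤ.+ + n
    sum-cond : sumℤ (map fun (window n)) ≡ sumℤ (window n)

module _ {n : ℕ} (w : AffPerm n) where
  open AffPerm w

  InImg : ℤ → Set
  InImg i = ∃[ j ] (j ℤ.≤ 0ℤ × 1ℤ ℤ.- fun j ≡ i)

  private
    lem : ∀ x → 1ℤ ℤ.- (1ℤ ℤ.- x) ≡ x
    lem = solve-∀

  inImg? : ∀ i → Dec (InImg i)
  inImg? i with inv (1ℤ ℤ.- i) ℤ.≤? 0ℤ
  ... | yes p = yes (inv (1ℤ ℤ.- i) , p ,
                     trans (cong (λ x → 1ℤ ℤ.- x) (fun-inv (1ℤ ℤ.- i))) (lem i))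
  ... | no ¬p = no λ { (j , j≤0 , e) →
          ¬p (subst (ℤ._≤ 0ℤ)
                    (sym (trans (cong inv (sym (trans (sym (lem (fun j))) (cong (λ x → 1ℤ ℤ.- x) e))))
                                (inv-fun j)))
                    j≤0) }

  -- D(w) = Σ_{k=1}^n |w(k) - k| ; every element of the two index sets
  -- below lies in [-D, D] (since |w(j) - j| ≤ D for all j by periodicity).
  bound : ℕ
  bound = foldr ℕ._+_ 0 (map (λ k → ℤ.∣ fun k ℤ.- k ∣) (window n))

  range : List ℤ
  range = map (λ k → + k ℤ.- + bound) (upTo (suc (2 ℕ.* bound)))

  negSet : List ℤ
  negSet = filter (λ i → (i ℤ.≤? 0ℤ) ×-dec inImg? i) range

  posSet : List ℤ
  posSet = filter (λ i → (0ℤ ℤ.<? i) ×-dec ¬? (inImg? i)) range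

-- Formal expressions for elements of Λ(x‖a) = ℚ[a][p_1[x-a], p_2[x-a], …]

data Λexpr : Set where
  aᵉ   : ℤ → Λexpr
  pᵉ   : (r : ℕ) → .{{NonZero r}} → Λexpr
  0ᵉ 1ᵉ : Λexpr
  _+ᵉ_ _*ᵉ_ : Λexpr → Λexpr → Λexpr
  -ᵉ_  : Λexpr → Λexpr

sumᵉ : List Λexpr → Λexpr
sumᵉ = foldr _+ᵉ_ 0ᵉ

signᵉ : ℕ → Λexpr
signᵉ zero    = 1ᵉ
signᵉ (suc m) = -ᵉ signᵉ m

eᵉ : ℕ → List Λexpr → Λexpr
eᵉ zero    _        = 1ᵉ
eᵉ (suc m) []       = 0ᵉ
eᵉ (suc m) (x ∷ xs) = (x *ᵉ eᵉ m xs) +ᵉ eᵉ (suc m) xs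

avars : ℕ → List Λexpr
avars r = map (λ k → aᵉ (1ℤ ℤ.- + k)) (upTo r)

m̃ : ℕ → Λexpr
m̃ r = sumᵉ (map (λ k → (signᵉ (r ℕ.∸ suc k) *ᵉ eᵉ (r ℕ.∸ suc k) (avars r)) *ᵉ pᵉ (suc k))
                (upTo r))

-- ε_w followed by ℚ[a] → S, composed with an arbitrary ring map S → R
-- (given by the images α(i) of a_i, which must be n-periodic).

module _ {c ℓ : Level} (R : CommutativeRing c ℓ) where
  open CommutativeRing R

  powR : Carrier → ℕ → Carrier
  powR x zero    = 1#
  powR x (suc m) = x * powR x m

  sumR : List Carrier → Carrier
  sumR = foldr _+_ 0#

  εp : {n : ℕ} → AffPerm n → (ℤ → Carrier) → ℕ → Carrier
  εp w α r = sumR (map (λ i → powR (α i) r) (negSet w))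
             - sumR (map (λ i → powR (α i) r) (posSet w))

  εeval : {n : ℕ} → AffPerm n → (ℤ → Carrier) → Λexpr → Carrier
  εeval w α (aᵉ i)    = α i
  εeval w α (pᵉ r)    = εp w α r
  εeval w α 0ᵉ        = 0#
  εeval w α 1ᵉ        = 1#
  εeval w α (f +ᵉ g)  = εeval w α f + εeval w α g
  εeval w α (f *ᵉ g)  = εeval w α f * εeval w α g
  εeval w α (-ᵉ f)    = - εeval w α f

module Submission where

-- Write B = (a₁, a₀, …, a₂₋ᵣ) and N, P for the index sets ℤ≤0 ∩ (1 − w(ℤ≤0)) and ℤ>0 ∖ (1 − w(ℤ≤0)).
-- Then ε_w(m̃_r) = Σ_{i∈N} F(aᵢ) − Σ_{i∈P} F(aᵢ) with F(x) = Σ_{j=1}^r (−1)^{r−j} e_{r−j}(B) x^j, and by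
-- Vieta F(x) = ∏_{b∈B} (x − b) − (−1)^r e_r(B). When r ≥ n the indices 1, 0, …, 2 − r meet every residue class
-- mod n, so each aᵢ is a root of the product and F takes the same value on all of them; it remains to show
-- |N| = |P|. Under j ↦ 1 − w(j) this says that the net number c(t) = #{j ≤ t < w j} − #{w j ≤ t < j} of
-- indices crossing the cut after t vanishes at t = 0. Since w is a bijection, c(t) does not depend on t, and by
-- periodicity c(1) + ⋯ + c(n) = Σ_{ρ=1}^n (w(ρ) − ρ) = 0.

open import Defs
open import Algebra.Bundles using (CommutativeRing)
open import Data.Integer as ℤ using (ℤ; +_; -[1+_]; 0ℤ; 1ℤ)
open import Data.Integer.DivMod using (_%ℕ_; _/ℕ_; n%ℕd<d; a≡a%ℕn+[a/ℕn]*n)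
import Data.Integer.Properties as ℤP
open import Data.Integer.Tactic.RingSolver using (solve-∀)
open import Data.List using (List; []; _∷_; map; foldr; upTo; applyUpTo; filter; length)
import Data.List.Properties as List
open import Data.List.Membership.Propositional using (_∈_)
open import Data.List.Membership.Propositional.Properties using (∈-map⁺; ∈-upTo⁺)
open import Data.List.Relation.Unary.Any using (Any; here; there)
import Data.List.Relation.Unary.Any.Properties as Any
open import Data.Nat as ℕ using (ℕ; zero; suc; z≤n; s≤s; z<s; s<s)
import Data.Nat.Properties as ℕP
open import Data.Product using (_×_; _,_; proj₁; proj₂)
open import Data.Sum using (inj₁; inj₂)
open import Function using (_∘_)
open import Relation.Binary.Bundles using (Setoid)
import Relation.Binary.PropositionalEquality as ≡
open import Relation.Nullary using (Dec; yes; no; ¬_; ¬?; _×-dec_; contradiction)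

module FiniteSum {c ℓ} (R : CommutativeRing c ℓ) where
  open CommutativeRing R
  open import Relation.Binary.Reasoning.Setoid setoid
  open import Algebra.Properties.AbelianGroup +-abelianGroup using (⁻¹-∙-comm; ε⁻¹≈ε)
  open import Algebra.Solver.Ring.NaturalCoefficients.Default commutativeSemiring using (solve; _:=_; _:+_)

  ∑< : ℕ → (ℕ → Carrier) → Carrier
  ∑< zero    f = 0#
  ∑< (suc m) f = f 0 + ∑< m (f ∘ suc)

  syntax ∑< m (λ k → e) = ∑[ k < m ] e

  ∑-cong : ∀ m {f g : ℕ → Carrier} → (∀ k → k ℕ.< m → f k ≈ g k) → ∑< m f ≈ ∑< m g
  ∑-cong zero    f≈g = refl
  ∑-cong (suc m) f≈g = +-cong (f≈g 0 z<s) (∑-cong m (λ k k<m → f≈g (suc k) (s<s k<m)))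

  ∑-distrib-+ : ∀ m (f g : ℕ → Carrier) → ∑[ k < m ] (f k + g k) ≈ ∑< m f + ∑< m g
  ∑-distrib-+ zero    f g = sym (+-identityʳ 0#)
  ∑-distrib-+ (suc m) f g = begin
    (f 0 + g 0) + ∑[ k < m ] (f (suc k) + g (suc k))    ≈⟨ +-congˡ (∑-distrib-+ m (f ∘ suc) (g ∘ suc)) ⟩
    (f 0 + g 0) + (∑< m (f ∘ suc) + ∑< m (g ∘ suc))     ≈⟨ solve 4 (λ a b c d → (a :+ b) :+ (c :+ d) := (a :+ c) :+ (b :+ d)) refl _ _ _ _ ⟩
    (f 0 + ∑< m (f ∘ suc)) + (g 0 + ∑< m (g ∘ suc))     ∎

  ∑-neg : ∀ m (f : ℕ → Carrier) → ∑[ k < m ] (- f k) ≈ - ∑< m f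
  ∑-neg zero    f = sym ε⁻¹≈ε
  ∑-neg (suc m) f = trans (+-congˡ (∑-neg m (f ∘ suc))) (⁻¹-∙-comm (f 0) _)

  ∑-distrib-sub : ∀ m (f g : ℕ → Carrier) → ∑[ k < m ] (f k - g k) ≈ ∑< m f - ∑< m g
  ∑-distrib-sub m f g = trans (∑-distrib-+ m f (λ k → - g k)) (+-congˡ (∑-neg m g))

  ∑-distribˡ-* : ∀ m x (f : ℕ → Carrier) → ∑[ k < m ] (x * f k) ≈ x * ∑< m f
  ∑-distribˡ-* zero    x f = sym (zeroʳ x)
  ∑-distribˡ-* (suc m) x f = trans (+-congˡ (∑-distribˡ-* m x (f ∘ suc))) (sym (distribˡ x _ _))

  ∑-zero : ∀ m → ∑[ k < m ] 0# ≈ 0#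
  ∑-zero zero    = refl
  ∑-zero (suc m) = trans (+-identityˡ _) (∑-zero m)

  ∑-++ : ∀ a b (f : ℕ → Carrier) → ∑< (a ℕ.+ b) f ≈ ∑< a f + ∑[ k < b ] f (a ℕ.+ k)
  ∑-++ zero    b f = sym (+-identityˡ _)
  ∑-++ (suc a) b f = trans (+-congˡ (∑-++ a b (f ∘ suc))) (sym (+-assoc _ _ _))

  ∑-blocks : ∀ m n (f : ℕ → Carrier) → ∑< (m ℕ.* n) f ≈ ∑[ k < m ] ∑[ ρ < n ] f (k ℕ.* n ℕ.+ ρ)
  ∑-blocks zero    n f = refl
  ∑-blocks (suc m) n f = trans (∑-++ n (m ℕ.* n) f) (+-congˡ (trans (∑-blocks m n (λ k → f (n ℕ.+ k)))
    (∑-cong m (λ k _ → ∑-cong n (λ ρ _ → reflexive (≡.cong f (≡.sym (ℕP.+-assoc n (k ℕ.* n) ρ))))))))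

  ∑-comm : ∀ m n (f : ℕ → ℕ → Carrier) → ∑[ i < m ] ∑[ j < n ] f i j ≈ ∑[ j < n ] ∑[ i < m ] f i j
  ∑-comm zero    n f = sym (∑-zero n)
  ∑-comm (suc m) n f = trans (+-congˡ (∑-comm m n (f ∘ suc))) (sym (∑-distrib-+ n (f 0) _))

  ∑-last : ∀ m (f : ℕ → Carrier) → ∑< (suc m) f ≈ ∑< m f + f m
  ∑-last zero    f = +-comm (f 0) 0#
  ∑-last (suc m) f = trans (+-congˡ (∑-last m (f ∘ suc))) (sym (+-assoc _ _ _))

  ∑-reverse : ∀ m (f : ℕ → Carrier) → ∑< m f ≈ ∑[ k < m ] f (m ℕ.∸ suc k)
  ∑-reverse zero    f = refl
  ∑-reverse (suc m) f = trans (∑-last m f) (trans (+-comm _ (f m)) (+-congˡ (∑-reverse m f)))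

  foldr-map-applyUpTo : ∀ {a} {A : Set a} (f : A → Carrier) (g : ℕ → A) m →
                        foldr _+_ 0# (map f (applyUpTo g m)) ≈ ∑[ k < m ] f (g k)
  foldr-map-applyUpTo f g zero    = refl
  foldr-map-applyUpTo f g (suc m) = +-congˡ (foldr-map-applyUpTo f (g ∘ suc) m)

  foldr-map-∑ : ∀ {a} {A : Set a} m (h : ℕ → A → Carrier) xs →
                ∑[ k < m ] foldr _+_ 0# (map (h k) xs) ≈ foldr _+_ 0# (map (λ i → ∑[ k < m ] h k i) xs)
  foldr-map-∑ m h []       = ∑-zero m
  foldr-map-∑ m h (x ∷ xs) = trans (∑-distrib-+ m (λ k → h k x) _) (+-congˡ (foldr-map-∑ m h xs))

  *-distribˡ-foldr : ∀ {a} {A : Set a} c (f : A → Carrier) xs →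
                     c * foldr _+_ 0# (map f xs) ≈ foldr _+_ 0# (map (λ i → c * f i) xs)
  *-distribˡ-foldr c f []       = zeroʳ c
  *-distribˡ-foldr c f (x ∷ xs) = trans (distribˡ c _ _) (+-congˡ (*-distribˡ-foldr c f xs))

  foldr-map-const : ∀ {a} {A : Set a} x (xs ys : List A) → length xs ≡.≡ length ys →
                    foldr _+_ 0# (map (λ _ → x) xs) ≈ foldr _+_ 0# (map (λ _ → x) ys)
  foldr-map-const x []       []       _  = refl
  foldr-map-const x (_ ∷ xs) (_ ∷ ys) eq = +-congˡ (foldr-map-const x xs ys (ℕP.suc-injective eq))

  foldr-map-cong : ∀ {a} {A : Set a} {f g : A → Carrier} → (∀ i → f i ≈ g i) → ∀ xs →
                   foldr _+_ 0# (map f xs) ≈ foldr _+_ 0# (map g xs)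
  foldr-map-cong f≈g []       = refl
  foldr-map-cong f≈g (x ∷ xs) = +-cong (f≈g x) (foldr-map-cong f≈g xs)

module IntegerSums where
  open import Data.Integer using (_+_; _-_; _*_; -_; _≤_; _<_; _≤?_; _<?_; _≟_)
  open ≡ using (_≡_; refl; sym; trans; cong; cong₂; subst; module ≡-Reasoning)
  open FiniteSum ℤP.+-*-commutativeRing public
  open ≡-Reasoning

  -- Linear inequalities are proved by writing the relevant difference as a sum (_⊕_) of terms already
  -- known to be nonnegative and checking the resulting identity with the ring solver (_by_).

  Nonneg : ℤ → Set
  Nonneg e = 0ℤ ≤ e

  infixl 6 _⊕_
  _⊕_ : ∀ {x y} → Nonneg x → Nonneg y → Nonneg (x + y)
  _⊕_ = ℤP.+-mono-≤

  ⟨+_⟩ : ∀ k → Nonneg (+ k)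
  ⟨+ k ⟩ = ℤ.+≤+ z≤n

  infix 4 _by_
  _by_ : ∀ {x y} → Nonneg x → x ≡ y → Nonneg y
  p by refl = p

  ≤⇒nonneg : ∀ {a b} → a ≤ b → Nonneg (b - a)
  ≤⇒nonneg = ℤP.i≤j⇒0≤j-i

  nonneg⇒≤ : ∀ {a b} → Nonneg (b - a) → a ≤ b
  nonneg⇒≤ = ℤP.0≤i-j⇒j≤i

  <⇒nonneg : ∀ {a b} → a < b → Nonneg (b - a - 1ℤ)
  <⇒nonneg {a} {b} a<b = ≤⇒nonneg (ℤP.i<j⇒suc[i]≤j a<b) by lemma b a
    where lemma : ∀ b a → b - (1ℤ + a) ≡ b - a - 1ℤ
          lemma = solve-∀

  nonneg⇒< : ∀ {a b} → Nonneg (b - a - 1ℤ) → a < b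
  nonneg⇒< {a} {b} p = ℤP.suc[i]≤j⇒i<j (nonneg⇒≤ (p by lemma b a))
    where lemma : ∀ b a → b - a - 1ℤ ≡ b - (1ℤ + a)
          lemma = solve-∀

  𝟙 : ∀ {a} {A : Set a} → Dec A → ℤ
  𝟙 (yes _) = 1ℤ
  𝟙 (no  _) = 0ℤ

  ⟦_≤_⟧ : ℤ → ℤ → ℤ
  ⟦ x ≤ y ⟧ = 𝟙 (x ≤? y)

  ⟦_≡_⟧ : ℤ → ℤ → ℤ
  ⟦ x ≡ y ⟧ = 𝟙 (x ≟ y)

  𝟙-yes : ∀ {a} {A : Set a} (d : Dec A) → A → 𝟙 d ≡ 1ℤ
  𝟙-yes (yes _) _ = refl
  𝟙-yes (no ¬a) a = contradiction a ¬a

  𝟙-no : ∀ {a} {A : Set a} (d : Dec A) → ¬ A → 𝟙 d ≡ 0ℤ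
  𝟙-no (yes a) ¬a = contradiction a ¬a
  𝟙-no (no _)  _  = refl

  𝟙-cong : ∀ {a b} {A : Set a} {B : Set b} → (A → B) → (B → A) → (d : Dec A) (e : Dec B) → 𝟙 d ≡ 𝟙 e
  𝟙-cong f g (yes a) e = sym (𝟙-yes e (f a))
  𝟙-cong f g (no ¬a) e = sym (𝟙-no e (λ b → ¬a (g b)))

  𝟙-× : ∀ {a b} {A : Set a} {B : Set b} (d : Dec A) (e : Dec B) → 𝟙 (d ×-dec e) ≡ 𝟙 d * 𝟙 e
  𝟙-× (yes _) (yes _) = refl
  𝟙-× (yes _) (no _)  = refl
  𝟙-× (no _)  (yes _) = refl
  𝟙-× (no _)  (no _)  = refl

  𝟙-¬ : ∀ {a} {A : Set a} (d : Dec A) → 𝟙 (¬? d) ≡ 1ℤ - 𝟙 d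
  𝟙-¬ (yes _) = refl
  𝟙-¬ (no _)  = refl

  ⟦≤⟧-suc : ∀ x t → ⟦ x ≤ 1ℤ + t ⟧ - ⟦ x ≤ t ⟧ ≡ ⟦ x ≡ 1ℤ + t ⟧
  ⟦≤⟧-suc x t with x ≤? t
  ... | yes x≤t = trans (cong (_- 1ℤ) (𝟙-yes (x ≤? 1ℤ + t) (ℤP.i≤j⇒i≤1+j x≤t)))
                        (sym (𝟙-no (x ≟ 1ℤ + t) λ { refl → ℤP.i≢suc[i] (ℤP.≤-antisym (ℤP.i≤suc[i] t) x≤t) }))
  ... | no x≰t  = trans (ℤP.+-identityʳ _) (𝟙-cong (λ x≤1+t → ℤP.≤-antisym x≤1+t (ℤP.i<j⇒suc[i]≤j (ℤP.≰⇒> x≰t)))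
                                                   ℤP.≤-reflexive (x ≤? 1ℤ + t) (x ≟ 1ℤ + t))

  ⟦≤⟧-shift : ∀ x y t → ⟦ x + y ≤ t ⟧ ≡ ⟦ x ≤ t - y ⟧
  ⟦≤⟧-shift x y t = 𝟙-cong (λ p → nonneg⇒≤ (≤⇒nonneg p by lemma x y t))
                           (λ p → nonneg⇒≤ (≤⇒nonneg p by sym (lemma x y t))) (x + y ≤? t) (x ≤? t - y)
    where lemma : ∀ x y t → t - (x + y) ≡ t - y - x
          lemma = solve-∀

  𝟙-0< : ∀ x → 𝟙 (0ℤ <? x) ≡ 1ℤ - ⟦ x ≤ 0ℤ ⟧
  𝟙-0< x = trans (𝟙-cong ℤP.<⇒≱ ℤP.≰⇒> (0ℤ <? x) (¬? (x ≤? 0ℤ))) (𝟙-¬ (x ≤? 0ℤ))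

  ⟦1-x≤0⟧ : ∀ x → ⟦ 1ℤ - x ≤ 0ℤ ⟧ ≡ 𝟙 (0ℤ <? x)
  ⟦1-x≤0⟧ x = 𝟙-cong (λ p → nonneg⇒< (≤⇒nonneg p by lemma x)) (λ p → nonneg⇒≤ (<⇒nonneg p by sym (lemma x)))
                     (1ℤ - x ≤? 0ℤ) (0ℤ <? x)
    where lemma : ∀ x → 0ℤ - (1ℤ - x) ≡ x - 0ℤ - 1ℤ
          lemma = solve-∀

  +suc≡suc+ : ∀ a s → a + + suc s ≡ (1ℤ + a) + + s
  +suc≡suc+ a s = lemma a (+ s)
    where lemma : ∀ a b → a + (1ℤ + b) ≡ (1ℤ + a) + b
          lemma = solve-∀

  ∑-⟦≤⟧-all : ∀ L {y a} → y ≤ a → ∑[ s < L ] ⟦ y ≤ a + + s ⟧ ≡ + L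
  ∑-⟦≤⟧-all zero    y≤a = refl
  ∑-⟦≤⟧-all (suc L) {y} {a} y≤a = cong₂ _+_
    (𝟙-yes (y ≤? a + + 0) (subst (y ≤_) (sym (ℤP.+-identityʳ a)) y≤a))
    (trans (∑-cong L (λ s _ → cong ⟦ y ≤_⟧ (+suc≡suc+ a s))) (∑-⟦≤⟧-all L (ℤP.i≤j⇒i≤1+j y≤a)))

  ∑-⟦≤⟧ : ∀ L {y a} → a ≤ y → y ≤ a + + L → ∑[ s < L ] ⟦ y ≤ a + + s ⟧ ≡ a + + L - y
  ∑-⟦≤⟧ zero {y} {a} a≤y y≤a+0 = sym (trans (cong (_- y) a+0≡y) (ℤP.+-inverseʳ y))
    where a+0≡y : a + + 0 ≡ y
          a+0≡y = ℤP.≤-antisym (ℤP.≤-trans (ℤP.≤-reflexive (ℤP.+-identityʳ a)) a≤y) y≤a+0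
  ∑-⟦≤⟧ (suc L) {y} {a} a≤y y≤a+L with y ≤? a + + 0
  ... | yes y≤a = begin
    1ℤ + ∑[ s < L ] ⟦ y ≤ a + + suc s ⟧         ≡⟨ cong (_+_ 1ℤ) (∑-cong L (λ s _ → cong ⟦ y ≤_⟧ (+suc≡suc+ a s))) ⟩
    1ℤ + ∑[ s < L ] ⟦ y ≤ (1ℤ + a) + + s ⟧      ≡⟨ cong (_+_ 1ℤ) (∑-⟦≤⟧-all L (ℤP.i≤j⇒i≤1+j y≤a′)) ⟩
    1ℤ + + L                                   ≡⟨ lemma a (+ L) ⟩
    a + + suc L - a                            ≡⟨ cong (λ z → a + + suc L - z) (ℤP.≤-antisym a≤y y≤a′) ⟩
    a + + suc L - y                            ∎
    where y≤a′ : y ≤ a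
          y≤a′ = ℤP.≤-trans y≤a (ℤP.≤-reflexive (ℤP.+-identityʳ a))
          lemma : ∀ a l → 1ℤ + l ≡ a + (1ℤ + l) - a
          lemma = solve-∀
  ... | no y≰a = begin
    0ℤ + ∑[ s < L ] ⟦ y ≤ a + + suc s ⟧         ≡⟨ cong (_+_ 0ℤ) (∑-cong L (λ s _ → cong ⟦ y ≤_⟧ (+suc≡suc+ a s))) ⟩
    0ℤ + ∑[ s < L ] ⟦ y ≤ (1ℤ + a) + + s ⟧      ≡⟨ cong (_+_ 0ℤ) (∑-⟦≤⟧ L 1+a≤y (subst (y ≤_) (+suc≡suc+ a L) y≤a+L)) ⟩
    0ℤ + ((1ℤ + a) + + L - y)                  ≡⟨ lemma a (+ L) y ⟩
    a + + suc L - y                            ∎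
    where 1+a≤y : 1ℤ + a ≤ y
          1+a≤y = ℤP.i<j⇒suc[i]≤j (ℤP.≰⇒> (λ y≤a → y≰a (subst (y ≤_) (sym (ℤP.+-identityʳ a)) y≤a)))
          lemma : ∀ a l y → 0ℤ + ((1ℤ + a) + l - y) ≡ a + (1ℤ + l) - y
          lemma = solve-∀

  _∈[_,_⟩ : ℤ → ℤ → ℤ → Set
  x ∈[ a , b ⟩ = a ≤ x × x < b

  _∈?[_,_⟩ : ∀ x a b → Dec (x ∈[ a , b ⟩)
  x ∈?[ a , b ⟩ = (a ≤? x) ×-dec (x <? b)

  ∈[,⟩-split : ∀ a L c → ⟦ a ≡ c ⟧ + 𝟙 (c ∈?[ 1ℤ + a , (1ℤ + a) + + L ⟩) ≡ 𝟙 (c ∈?[ a , a + + suc L ⟩)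
  ∈[,⟩-split a L c with a ≟ c
  ... | yes refl = trans (cong (_+_ 1ℤ) (𝟙-no (c ∈?[ 1ℤ + c , (1ℤ + c) + + L ⟩)
                                             λ (1+c≤c , _) → ℤP.<-irrefl refl (ℤP.suc[i]≤j⇒i<j 1+c≤c)))
                         (sym (𝟙-yes (c ∈?[ c , c + + suc L ⟩) (ℤP.≤-refl , nonneg⇒< (⟨+ L ⟩ by lemma c (+ L)))))
    where lemma : ∀ c l → l ≡ c + (1ℤ + l) - c - 1ℤ
          lemma = solve-∀
  ... | no a≢c = trans (ℤP.+-identityˡ _) (𝟙-cong to from (c ∈?[ 1ℤ + a , (1ℤ + a) + + L ⟩) (c ∈?[ a , a + + suc L ⟩))
    where
      to : c ∈[ 1ℤ + a , (1ℤ + a) + + L ⟩ → c ∈[ a , a + + suc L ⟩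
      to (1+a≤c , c<) = ℤP.<⇒≤ (ℤP.suc[i]≤j⇒i<j 1+a≤c) , subst (c <_) (sym (+suc≡suc+ a L)) c<
      from : c ∈[ a , a + + suc L ⟩ → c ∈[ 1ℤ + a , (1ℤ + a) + + L ⟩
      from (a≤c , c<) = ℤP.i<j⇒suc[i]≤j (ℤP.≤∧≢⇒< a≤c a≢c) , subst (c <_) (+suc≡suc+ a L) c<

  ∑-sift : ∀ (F : ℤ → ℤ) L a c → ∑[ k < L ] (F (a + + k) * ⟦ a + + k ≡ c ⟧) ≡ F c * 𝟙 (c ∈?[ a , a + + L ⟩)
  ∑-sift F zero a c = sym (trans (cong (F c *_) (𝟙-no (c ∈?[ a , a + + 0 ⟩) empty)) (ℤP.*-zeroʳ (F c)))
    where empty : ¬ c ∈[ a , a + + 0 ⟩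
          empty (a≤c , c<a+0) = ℤP.<-irrefl refl (ℤP.≤-<-trans a≤c (subst (c <_) (ℤP.+-identityʳ a) c<a+0))
  ∑-sift F (suc L) a c = begin
    F (a + + 0) * ⟦ a + + 0 ≡ c ⟧ + ∑[ k < L ] (F (a + + suc k) * ⟦ a + + suc k ≡ c ⟧)
      ≡⟨ cong₂ _+_ (trans (cong (λ z → F z * ⟦ z ≡ c ⟧) (ℤP.+-identityʳ a)) (sifted (a ≟ c)))
                   (∑-cong L (λ k _ → cong (λ z → F z * ⟦ z ≡ c ⟧) (+suc≡suc+ a k))) ⟩
    F c * ⟦ a ≡ c ⟧ + ∑[ k < L ] (F ((1ℤ + a) + + k) * ⟦ (1ℤ + a) + + k ≡ c ⟧)
      ≡⟨ cong (_+_ (F c * ⟦ a ≡ c ⟧)) (∑-sift F L (1ℤ + a) c) ⟩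
    F c * ⟦ a ≡ c ⟧ + F c * 𝟙 (c ∈?[ 1ℤ + a , (1ℤ + a) + + L ⟩)
      ≡⟨ trans (sym (ℤP.*-distribˡ-+ (F c) _ _)) (cong (F c *_) (∈[,⟩-split a L c)) ⟩
    F c * 𝟙 (c ∈?[ a , a + + suc L ⟩) ∎
    where sifted : (d : Dec (a ≡ c)) → F a * 𝟙 d ≡ F c * 𝟙 d
          sifted (yes refl) = refl
          sifted (no _)     = trans (ℤP.*-zeroʳ (F a)) (sym (ℤP.*-zeroʳ (F c)))

  ∑-⟦≡⟧ : ∀ L {a c} → c ∈[ a , a + + L ⟩ → ∑[ k < L ] ⟦ a + + k ≡ c ⟧ ≡ 1ℤ
  ∑-⟦≡⟧ L {a} {c} c∈ = trans (∑-cong L (λ k _ → sym (ℤP.*-identityˡ _)))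
                             (trans (∑-sift (λ _ → 1ℤ) L a c)
                                    (trans (ℤP.*-identityˡ _) (𝟙-yes (c ∈?[ a , a + + L ⟩) c∈)))

  -- Both sides equal Σ_{k,s} F (b + s) ⟦ b + s ≡ ψ (a + k) ⟧, summed over s first or over k first.
  ∑-reindex : ∀ {φ ψ : ℤ → ℤ} → (∀ i → φ (ψ i) ≡ i) → (∀ j → ψ (φ j) ≡ j) →
              ∀ (F : ℤ → ℤ) a L b M →
              (∀ k → k ℕ.< L → ψ (a + + k) ∈[ b , b + + M ⟩) →
              (∀ s → s ℕ.< M → ¬ φ (b + + s) ∈[ a , a + + L ⟩ → F (b + + s) ≡ 0ℤ) →
              ∑[ k < L ] F (ψ (a + + k)) ≡ ∑[ s < M ] F (b + + s)
  ∑-reindex {φ} {ψ} φψ ψφ F a L b M ψ-into support = begin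
    ∑[ k < L ] F (ψ (a + + k))
      ≡⟨ ∑-cong L (λ k k<L → sym (trans (∑-sift F M b (ψ (a + + k)))
                                      (trans (cong (F (ψ (a + + k)) *_) (𝟙-yes _ (ψ-into k k<L))) (ℤP.*-identityʳ _)))) ⟩
    ∑[ k < L ] ∑[ s < M ] (F (b + + s) * ⟦ b + + s ≡ ψ (a + + k) ⟧)
      ≡⟨ ∑-comm L M _ ⟩
    ∑[ s < M ] ∑[ k < L ] (F (b + + s) * ⟦ b + + s ≡ ψ (a + + k) ⟧)
      ≡⟨ ∑-cong M (λ s s<M → trans (∑-distribˡ-* L (F (b + + s)) _) (hit s s<M)) ⟩
    ∑[ s < M ] F (b + + s) ∎
    where
      transpose : ∀ j i → ⟦ j ≡ ψ i ⟧ ≡ 1ℤ * ⟦ i ≡ φ j ⟧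
      transpose j i = trans (𝟙-cong (λ { refl → sym (φψ i) }) (λ { refl → sym (ψφ j) }) (j ≟ ψ i) (i ≟ φ j))
                            (sym (ℤP.*-identityˡ _))
      hit : ∀ s → s ℕ.< M → F (b + + s) * ∑[ k < L ] ⟦ b + + s ≡ ψ (a + + k) ⟧ ≡ F (b + + s)
      hit s s<M with φ (b + + s) ∈?[ a , a + + L ⟩ | ∑-sift (λ _ → 1ℤ) L a (φ (b + + s))
      ... | yes inside | sifted = trans (cong (F (b + + s) *_) (trans (∑-cong L (λ k _ → transpose _ _)) sifted))
                                        (ℤP.*-identityʳ _)
      ... | no outside | _      = trans (cong (_* _) F≡0) (trans (ℤP.*-zeroˡ (∑[ k < L ] ⟦ b + + s ≡ ψ (a + + k) ⟧)) (sym F≡0))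
        where F≡0 : F (b + + s) ≡ 0ℤ
              F≡0 = support s s<M outside

  ∑-const : ∀ L c → ∑[ k < L ] c ≡ + L * c
  ∑-const zero    c = sym (ℤP.*-zeroˡ c)
  ∑-const (suc L) c = trans (cong (_+_ c) (∑-const L c)) (sym (ℤP.suc-* (+ L) c))

  length-filter : ∀ {a p} {A : Set a} {P : A → Set p} (P? : ∀ x → Dec (P x)) xs →
                  + length (filter P? xs) ≡ foldr _+_ 0ℤ (map (𝟙 ∘ P?) xs)
  length-filter P? []       = refl
  length-filter P? (x ∷ xs) with P? x
  ... | yes _ = cong (_+_ 1ℤ) (length-filter P? xs)
  ... | no  _ = trans (length-filter P? xs) (sym (ℤP.+-identityˡ _))

module _ {a ℓ} (S : Setoid a ℓ) where
  open Setoid S using (Carrier; _≈_)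
  open import Data.Integer using (_+_; _*_; -_)
  open ≡ using (_≡_; refl; cong)
  private module S = Setoid S

  periodic-* : ∀ n (F : ℤ → Carrier) → (∀ i → F (i + + n) ≈ F i) → ∀ i q → F (i + q * + n) ≈ F i
  periodic-* n F per i (+ q)     = forward i q
    where
      forward : ∀ i q → F (i + + q * + n) ≈ F i
      forward i zero    = S.reflexive (cong F (ℤP.+-identityʳ i))
      forward i (suc q) = S.trans (S.reflexive (cong F (lemma i (+ q) (+ n)))) (S.trans (per _) (forward i q))
        where lemma : ∀ i q n → i + (1ℤ + q) * n ≡ (i + q * n) + n
              lemma = solve-∀
  periodic-* n F per i -[1+ q ]  = S.sym (S.trans (S.reflexive (cong F (lemma i (+ q) (+ n))))
                                                  (periodic-* n F per (i + -[1+ q ] * + n) (+ suc q)))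
    where lemma : ∀ i q n → i ≡ (i + (- (1ℤ + q)) * n) + (1ℤ + q) * n
          lemma = solve-∀

∈⇒≤sum : ∀ {k ks} → k ∈ ks → k ℕ.≤ foldr ℕ._+_ 0 ks
∈⇒≤sum (here ≡.refl) = ℕP.m≤m+n _ _
∈⇒≤sum (there k∈ks) = ℕP.≤-trans (∈⇒≤sum k∈ks) (ℕP.m≤n+m _ _)

module Crossings {m : ℕ} (w : AffPerm (suc m)) where
  open AffPerm w
  open IntegerSums
  open import Data.Integer using (_+_; _-_; _*_; -_; _≤_; _<_; _≤?_; _<?_; _≟_; ∣_∣)
  open ≡ using (_≡_; refl; sym; trans; cong; cong₂; subst; setoid; module ≡-Reasoning)
  open ≡-Reasoning

  n : ℕ
  n = suc m

  D : ℕ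
  D = bound w

  Within : ℤ → ℤ → Set
  Within x y = Nonneg (+ D - (y - x)) × Nonneg (+ D + (y - x))

  ∣∣≤⇒Within : ∀ x y → ∣ y - x ∣ ℕ.≤ D → Within x y
  ∣∣≤⇒Within x y ∣y-x∣≤D with ℤP.+∣i∣≡i⊎+∣i∣≡-i (y - x)
  ... | inj₁ eq = (≤⇒nonneg (ℤ.+≤+ ∣y-x∣≤D) by cong (_-_ (+ D)) eq) , (⟨+ D ⟩ ⊕ ⟨+ ∣ y - x ∣ ⟩ by cong (_+_ (+ D)) eq)
  ... | inj₂ eq = (⟨+ D ⟩ ⊕ ⟨+ ∣ y - x ∣ ⟩ by cong (_+_ (+ D)) eq)
                , (≤⇒nonneg (ℤ.+≤+ ∣y-x∣≤D) by trans (cong (_-_ (+ D)) eq) (cong (_+_ (+ D)) (ℤP.neg-involutive (y - x))))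

  Within-sym : ∀ {x y} → Within x y → Within y x
  Within-sym {x} {y} (p , q) = (q by lemma (+ D) x y) , (p by sym (lemma′ (+ D) x y))
    where lemma : ∀ d x y → d + (y - x) ≡ d - (x - y)
          lemma = solve-∀
          lemma′ : ∀ d x y → d + (x - y) ≡ d - (y - x)
          lemma′ = solve-∀

  Within-refl : ∀ x → Within x x
  Within-refl x = (⟨+ D ⟩ by lemma (+ D) x) , (⟨+ D ⟩ by lemma′ (+ D) x)
    where lemma : ∀ d x → d ≡ d - (x - x)
          lemma = solve-∀
          lemma′ : ∀ d x → d ≡ d + (x - x)
          lemma′ = solve-∀

  fun-periodic : ∀ j q → fun (j + q * + n) ≡ fun j + q * + n
  fun-periodic j q = begin
    fun (j + y)                           ≡⟨ lemma (fun (j + y)) (j + y) ⟩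
    displacement (j + y) + (j + y)        ≡⟨ cong (_+ (j + y)) (periodic-* (setoid ℤ) n displacement displacement-periodic j q) ⟩
    displacement j + (j + y)              ≡⟨ lemma′ (fun j) j y ⟩
    fun j + y                             ∎
    where
      y : ℤ
      y = q * + n
      displacement : ℤ → ℤ
      displacement i = fun i - i
      displacement-periodic : ∀ i → displacement (i + + n) ≡ displacement i
      displacement-periodic i = trans (cong (_- (i + + n)) (periodic i)) (lemma″ (fun i) i (+ n))
        where lemma″ : ∀ f i n → (f + n) - (i + n) ≡ f - i
              lemma″ = solve-∀
      lemma : ∀ a b → a ≡ (a - b) + b
      lemma = solve-∀
      lemma′ : ∀ f j y → (f - j) + (j + y) ≡ f + y
      lemma′ = solve-∀

  fun-displacement : ∀ j → Within j (fun j)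
  fun-displacement j = ∣∣≤⇒Within j (fun j) (subst (ℕ._≤ D) (cong ∣_∣ (sym reduce)) (∈⇒≤sum member))
    where
      ρ : ℕ
      ρ = (j - 1ℤ) %ℕ n
      q : ℤ
      q = (j - 1ℤ) /ℕ n
      x : ℤ
      x = + suc ρ
      j≡x+qn : j ≡ x + q * + n
      j≡x+qn = trans (lemma j) (trans (cong (_+_ 1ℤ) (a≡a%ℕn+[a/ℕn]*n (j - 1ℤ) n)) (lemma′ (+ ρ) (q * + n)))
        where lemma : ∀ j → j ≡ 1ℤ + (j - 1ℤ)
              lemma = solve-∀
              lemma′ : ∀ r y → 1ℤ + (r + y) ≡ (1ℤ + r) + y
              lemma′ = solve-∀
      reduce : fun j - j ≡ fun x - x
      reduce = trans (cong (λ z → fun z - z) j≡x+qn) (trans (cong (_- (x + q * + n)) (fun-periodic x q)) (lemma (fun x) x (q * + n)))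
        where lemma : ∀ f x y → (f + y) - (x + y) ≡ f - x
              lemma = solve-∀
      member : ∣ fun x - x ∣ ∈ map (λ k → ∣ fun k - k ∣) (window n)
      member = ∈-map⁺ (λ k → ∣ fun k - k ∣) (∈-map⁺ (λ k → + suc k) (∈-upTo⁺ (n%ℕd<d (j - 1ℤ) n)))

  inv-displacement : ∀ k → Within k (inv k)
  inv-displacement k = Within-sym {inv k} {k} (subst (Within (inv k)) (fun-inv k) (fun-displacement (inv k)))

  -- Near y means y ∈ [1 − 2D, n + 2D]. Every point the argument inspects is near, and near points lie both
  -- in the summation window [1 − K, 1 + K) and in the sweep range [1 + n − K, 1 + n + K].
  Near : ℤ → Set
  Near y = Nonneg (y - 1ℤ + + D + + D) × Nonneg (+ n + + D + + D - y)

  near : ∀ {x y} → Nonneg (x - 1ℤ + + D) → Nonneg (+ n + + D - x) → Within x y → Near y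
  near {x} {y} p q (r , s) = (p ⊕ s by lemma (+ D) x y) , (q ⊕ r by lemma′ (+ n) (+ D) x y)
    where lemma : ∀ d x y → x - 1ℤ + d + (d + (y - x)) ≡ y - 1ℤ + d + d
          lemma = solve-∀
          lemma′ : ∀ n d x y → n + d - x + (d - (y - x)) ≡ n + d + d - y
          lemma′ = solve-∀

  near-window : ∀ t y → t ℕ.< n → Within (1ℤ + + t) y → Near y
  near-window t y t<n = near {1ℤ + + t} {y} (⟨+ t ⟩ ⊕ ⟨+ D ⟩ by lemma (+ t) (+ D))
                             (≤⇒nonneg (ℤ.+≤+ (ℕP.≤-pred t<n)) ⊕ ⟨+ D ⟩ by lemma′ (+ m) (+ t) (+ D))
    where lemma : ∀ t d → t + d ≡ 1ℤ + t - 1ℤ + d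
          lemma = solve-∀
          lemma′ : ∀ m t d → m - t + d ≡ (1ℤ + m) + d - (1ℤ + t)
          lemma′ = solve-∀

  -- K is a multiple of n, so the window consists of whole periods, and K ≥ n + 2D (K-large).
  Q : ℕ
  Q = D ℕ.+ D ℕ.+ 1

  K : ℕ
  K = Q ℕ.* n

  len : ℕ
  len = (Q ℕ.+ Q) ℕ.* n

  +K : + K ≡ (+ D + + D + 1ℤ) * + n
  +K = trans (ℤP.pos-* Q n) (cong (_* + n) (trans (ℤP.pos-+ (D ℕ.+ D) 1) (cong (_+ 1ℤ) (ℤP.pos-+ D D))))

  +len : + len ≡ + K + + K
  +len = trans (cong +_ (ℕP.*-distribʳ-+ n Q Q)) (ℤP.pos-+ K K)

  K-large : Nonneg (+ K - + n - + D - + D)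
  K-large = ⟨+ (D ℕ.* m) ⟩ ⊕ ⟨+ (D ℕ.* m) ⟩ by trans (lemma (+ D) (+ m) (ℤP.pos-* D m)) (cong (λ k → k - + n - + D - + D) (sym +K))
    where lemma : ∀ d m {p} → p ≡ d * m → p + p ≡ (d + d + 1ℤ) * (1ℤ + m) - (1ℤ + m) - d - d
          lemma d m refl = lemma′ d m
            where lemma′ : ∀ d m → d * m + d * m ≡ (d + d + 1ℤ) * (1ℤ + m) - (1ℤ + m) - d - d
                  lemma′ = solve-∀

  window-start : ℤ
  window-start = 1ℤ - + K

  near⇒∈window : ∀ {x} → Near x → x ∈[ window-start , window-start + + len ⟩
  near⇒∈window {x} (p , q) = nonneg⇒≤ (p ⊕ K-large ⊕ ⟨+ n ⟩ by lemma x (+ K) (+ n) (+ D))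
                           , nonneg⇒< (q ⊕ K-large by trans (lemma′ x (+ K) (+ n) (+ D)) (cong (λ l → window-start + l - x - 1ℤ) (sym +len)))
    where lemma : ∀ x k n d → x - 1ℤ + d + d + (k - n - d - d) + n ≡ x - (1ℤ - k)
          lemma = solve-∀
          lemma′ : ∀ x k n d → n + d + d - x + (k - n - d - d) ≡ (1ℤ - k) + (k + k) - x - 1ℤ
          lemma′ = solve-∀

  sweep-start : ℤ
  sweep-start = 1ℤ + + n - + K

  near⇒∈sweep : ∀ {x} → Near x → sweep-start ≤ x × x ≤ sweep-start + + len
  near⇒∈sweep {x} (p , q) = nonneg⇒≤ (p ⊕ K-large by lemma x (+ K) (+ n) (+ D))
                          , nonneg⇒≤ (q ⊕ K-large ⊕ ⟨+ n ⟩ ⊕ ⟨+ 1 ⟩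
                                      by trans (lemma′ x (+ K) (+ n) (+ D)) (cong (λ l → sweep-start + l - x) (sym +len)))
    where lemma : ∀ x k n d → x - 1ℤ + d + d + (k - n - d - d) ≡ x - (1ℤ + n - k)
          lemma = solve-∀
          lemma′ : ∀ x k n d → n + d + d - x + (k - n - d - d) + n + 1ℤ ≡ (1ℤ + n - k) + (k + k) - x
          lemma′ = solve-∀

  crossing : ℤ → ℤ → ℤ
  crossing t j = ⟦ j ≤ t ⟧ - ⟦ fun j ≤ t ⟧

  -- c(t) = #{j ≤ t < w j} − #{w j ≤ t < j}; for 0 ≤ t ≤ n every such j lies in the window [1 − K, 1 + K).
  netCrossings : ℤ → ℤ
  netCrossings t = ∑[ s < len ] crossing t (window-start + + s)

  ⟦fun≡⟧ : ∀ j x → ⟦ fun j ≡ x ⟧ ≡ ⟦ j ≡ inv x ⟧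
  ⟦fun≡⟧ j x = 𝟙-cong (λ e → trans (sym (inv-fun j)) (cong inv e)) (λ e → trans (cong fun e) (fun-inv x)) (fun j ≟ x) (j ≟ inv x)

  crossing-suc : ∀ t j → crossing (1ℤ + t) j - crossing t j ≡ ⟦ j ≡ 1ℤ + t ⟧ - ⟦ j ≡ inv (1ℤ + t) ⟧
  crossing-suc t j = begin
    (⟦ j ≤ 1ℤ + t ⟧ - ⟦ fun j ≤ 1ℤ + t ⟧) - (⟦ j ≤ t ⟧ - ⟦ fun j ≤ t ⟧)
      ≡⟨ lemma ⟦ j ≤ 1ℤ + t ⟧ ⟦ fun j ≤ 1ℤ + t ⟧ ⟦ j ≤ t ⟧ ⟦ fun j ≤ t ⟧ ⟩
    (⟦ j ≤ 1ℤ + t ⟧ - ⟦ j ≤ t ⟧) - (⟦ fun j ≤ 1ℤ + t ⟧ - ⟦ fun j ≤ t ⟧)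
      ≡⟨ cong₂ _-_ (⟦≤⟧-suc j t) (⟦≤⟧-suc (fun j) t) ⟩
    ⟦ j ≡ 1ℤ + t ⟧ - ⟦ fun j ≡ 1ℤ + t ⟧
      ≡⟨ cong (_-_ ⟦ j ≡ 1ℤ + t ⟧) (⟦fun≡⟧ j (1ℤ + t)) ⟩
    ⟦ j ≡ 1ℤ + t ⟧ - ⟦ j ≡ inv (1ℤ + t) ⟧ ∎
    where lemma : ∀ a b c d → (a - b) - (c - d) ≡ (a - c) - (b - d)
          lemma = solve-∀

  netCrossings-suc : ∀ t → Near (1ℤ + t) → Near (inv (1ℤ + t)) → netCrossings (1ℤ + t) ≡ netCrossings t
  netCrossings-suc t near-t near-inv = ℤP.i-j≡0⇒i≡j _ _ (begin
    netCrossings (1ℤ + t) - netCrossings t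
      ≡⟨ sym (∑-distrib-sub len _ _) ⟩
    ∑[ s < len ] (crossing (1ℤ + t) (j s) - crossing t (j s))
      ≡⟨ ∑-cong len (λ s _ → crossing-suc t (j s)) ⟩
    ∑[ s < len ] (⟦ j s ≡ 1ℤ + t ⟧ - ⟦ j s ≡ inv (1ℤ + t) ⟧)
      ≡⟨ ∑-distrib-sub len _ _ ⟩
    ∑[ s < len ] ⟦ j s ≡ 1ℤ + t ⟧ - ∑[ s < len ] ⟦ j s ≡ inv (1ℤ + t) ⟧
      ≡⟨ cong₂ _-_ (∑-⟦≡⟧ len (near⇒∈window near-t)) (∑-⟦≡⟧ len (near⇒∈window near-inv)) ⟩
    0ℤ ∎)
    where j : ℕ → ℤ
          j s = window-start + + s

  netCrossings-const : ∀ t → t ℕ.≤ n → netCrossings (+ t) ≡ netCrossings 0ℤ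
  netCrossings-const zero    _         = refl
  netCrossings-const (suc t) (s≤s t≤m) = trans
    (netCrossings-suc (+ t) (near-window t (1ℤ + + t) (s≤s t≤m) (Within-refl (1ℤ + + t)))
                            (near-window t (inv (1ℤ + + t)) (s≤s t≤m) (inv-displacement (1ℤ + + t))))
    (netCrossings-const t (ℕP.m≤n⇒m≤1+n t≤m))

  crossing-periodic : ∀ t x q → crossing t (x + q * + n) ≡ crossing (t - q * + n) x
  crossing-periodic t x q = cong₂ _-_ (⟦≤⟧-shift x (q * + n) t)
                                      (trans (cong (λ y → ⟦ y ≤ t ⟧) (fun-periodic x q)) (⟦≤⟧-shift (fun x) (q * + n) t))

  crossing-sweep : ∀ x → Near x → Near (fun x) → ∑[ s < len ] crossing (sweep-start + + s) x ≡ fun x - x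
  crossing-sweep x near-x near-fx = begin
    ∑[ s < len ] (⟦ x ≤ sweep-start + + s ⟧ - ⟦ fun x ≤ sweep-start + + s ⟧)
      ≡⟨ ∑-distrib-sub len _ _ ⟩
    ∑[ s < len ] ⟦ x ≤ sweep-start + + s ⟧ - ∑[ s < len ] ⟦ fun x ≤ sweep-start + + s ⟧
      ≡⟨ cong₂ _-_ (∑-⟦≤⟧ len (proj₁ (near⇒∈sweep near-x)) (proj₂ (near⇒∈sweep near-x)))
                   (∑-⟦≤⟧ len (proj₁ (near⇒∈sweep near-fx)) (proj₂ (near⇒∈sweep near-fx))) ⟩
    (sweep-start + + len - x) - (sweep-start + + len - fun x)
      ≡⟨ lemma (sweep-start + + len) x (fun x) ⟩
    fun x - x ∎
    where lemma : ∀ e x y → (e - x) - (e - y) ≡ y - x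
          lemma = solve-∀

  +[_*n+_] : ∀ a b → + (a ℕ.* n ℕ.+ b) ≡ + a * + n + + b
  +[ a *n+ b ] = trans (ℤP.pos-+ (a ℕ.* n) b) (cong (_+ + b) (ℤP.pos-* a n))

  -- Translating the k-th block of the window by a multiple of n moves j to 1 + ρ and shifts the cut by the
  -- opposite amount; reversing the block order makes the shifted cuts sweep upwards.
  reflected-block : ∀ t k ρ → k ℕ.< Q ℕ.+ Q →
                    crossing (1ℤ + + t) (window-start + + ((Q ℕ.+ Q ℕ.∸ suc k) ℕ.* n ℕ.+ ρ))
                      ≡ crossing (sweep-start + + (k ℕ.* n ℕ.+ t)) (+ suc ρ)
  reflected-block t k ρ k<2Q = begin
    crossing (1ℤ + + t) (window-start + + (r ℕ.* n ℕ.+ ρ))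
      ≡⟨ cong (crossing (1ℤ + + t)) (trans (cong₂ (λ a b → 1ℤ - a + b) (ℤP.pos-* Q n) +[ r *n+ ρ ])
                                          (lemma₁ (+ Q) (+ n) (+ r) (+ ρ))) ⟩
    crossing (1ℤ + + t) (+ suc ρ + (+ r - + Q) * + n)
      ≡⟨ crossing-periodic (1ℤ + + t) (+ suc ρ) (+ r - + Q) ⟩
    crossing (1ℤ + + t - (+ r - + Q) * + n) (+ suc ρ)
      ≡⟨ cong (λ a → crossing (1ℤ + + t - (a - + Q) * + n) (+ suc ρ)) +r ⟩
    crossing (1ℤ + + t - (+ Q + + Q - 1ℤ - + k - + Q) * + n) (+ suc ρ)
      ≡⟨ cong (λ a → crossing a (+ suc ρ)) (trans (lemma₂ (+ Q) (+ n) (+ k) (+ t))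
                                                (cong₂ (λ a b → 1ℤ + + n - a + b) (sym (ℤP.pos-* Q n)) (sym +[ k *n+ t ]))) ⟩
    crossing (sweep-start + + (k ℕ.* n ℕ.+ t)) (+ suc ρ) ∎
    where
      r : ℕ
      r = Q ℕ.+ Q ℕ.∸ suc k
      +r : + r ≡ + Q + + Q - 1ℤ - + k
      +r = trans (sym (ℤP.⊖-≥ k<2Q)) (trans (sym (ℤP.m-n≡m⊖n (Q ℕ.+ Q) (suc k)))
                 (trans (cong (_- + suc k) (ℤP.pos-+ Q Q)) (lemma₃ (+ Q) (+ k))))
        where lemma₃ : ∀ q k → q + q - (1ℤ + k) ≡ q + q - 1ℤ - k
              lemma₃ = solve-∀
      lemma₁ : ∀ q n r ρ → 1ℤ - q * n + (r * n + ρ) ≡ (1ℤ + ρ) + (r - q) * n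
      lemma₁ = solve-∀
      lemma₂ : ∀ q n k t → 1ℤ + t - (q + q - 1ℤ - k - q) * n ≡ 1ℤ + n - q * n + (k * n + t)
      lemma₂ = solve-∀

  netCrossings-blocks : ∀ t → netCrossings (1ℤ + + t)
                          ≡ ∑[ k < Q ℕ.+ Q ] ∑[ ρ < n ] crossing (sweep-start + + (k ℕ.* n ℕ.+ t)) (+ suc ρ)
  netCrossings-blocks t = begin
    netCrossings (1ℤ + + t)
      ≡⟨ ∑-blocks (Q ℕ.+ Q) n (λ s → crossing (1ℤ + + t) (window-start + + s)) ⟩
    ∑[ k < Q ℕ.+ Q ] ∑[ ρ < n ] crossing (1ℤ + + t) (window-start + + (k ℕ.* n ℕ.+ ρ))
      ≡⟨ ∑-reverse (Q ℕ.+ Q) (λ k → ∑[ ρ < n ] crossing (1ℤ + + t) (window-start + + (k ℕ.* n ℕ.+ ρ))) ⟩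
    ∑[ k < Q ℕ.+ Q ] ∑[ ρ < n ] crossing (1ℤ + + t) (window-start + + ((Q ℕ.+ Q ℕ.∸ suc k) ℕ.* n ℕ.+ ρ))
      ≡⟨ ∑-cong (Q ℕ.+ Q) (λ k k<2Q → ∑-cong n (λ ρ _ → reflected-block t k ρ k<2Q)) ⟩
    ∑[ k < Q ℕ.+ Q ] ∑[ ρ < n ] crossing (sweep-start + + (k ℕ.* n ℕ.+ t)) (+ suc ρ) ∎

  ∑-netCrossings≡∑-sweeps : ∑[ t < n ] netCrossings (1ℤ + + t) ≡ ∑[ ρ < n ] ∑[ s < len ] crossing (sweep-start + + s) (+ suc ρ)
  ∑-netCrossings≡∑-sweeps = begin
    ∑[ t < n ] netCrossings (1ℤ + + t)
      ≡⟨ ∑-cong n (λ t _ → netCrossings-blocks t) ⟩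
    ∑[ t < n ] ∑[ k < Q ℕ.+ Q ] ∑[ ρ < n ] X t k ρ
      ≡⟨ ∑-comm n (Q ℕ.+ Q) (λ t k → ∑[ ρ < n ] X t k ρ) ⟩
    ∑[ k < Q ℕ.+ Q ] ∑[ t < n ] ∑[ ρ < n ] X t k ρ
      ≡⟨ ∑-cong (Q ℕ.+ Q) (λ k _ → ∑-comm n n (λ t ρ → X t k ρ)) ⟩
    ∑[ k < Q ℕ.+ Q ] ∑[ ρ < n ] ∑[ t < n ] X t k ρ
      ≡⟨ ∑-comm (Q ℕ.+ Q) n (λ k ρ → ∑[ t < n ] X t k ρ) ⟩
    ∑[ ρ < n ] ∑[ k < Q ℕ.+ Q ] ∑[ t < n ] X t k ρ
      ≡⟨ ∑-cong n (λ ρ _ → sym (∑-blocks (Q ℕ.+ Q) n (λ s → crossing (sweep-start + + s) (+ suc ρ)))) ⟩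
    ∑[ ρ < n ] ∑[ s < len ] crossing (sweep-start + + s) (+ suc ρ) ∎
    where X : ℕ → ℕ → ℕ → ℤ
          X t k ρ = crossing (sweep-start + + (k ℕ.* n ℕ.+ t)) (+ suc ρ)

  netCrossings-average : ∑[ t < n ] netCrossings (1ℤ + + t) ≡ 0ℤ
  netCrossings-average = begin
    ∑[ t < n ] netCrossings (1ℤ + + t)
      ≡⟨ ∑-netCrossings≡∑-sweeps ⟩
    ∑[ ρ < n ] ∑[ s < len ] crossing (sweep-start + + s) (+ suc ρ)
      ≡⟨ ∑-cong n (λ ρ ρ<n → crossing-sweep (+ suc ρ) (near-window ρ (+ suc ρ) ρ<n (Within-refl (+ suc ρ)))
                                                       (near-window ρ (fun (+ suc ρ)) ρ<n (fun-displacement (+ suc ρ)))) ⟩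
    ∑[ ρ < n ] (fun (+ suc ρ) - + suc ρ)
      ≡⟨ ∑-distrib-sub n (λ ρ → fun (+ suc ρ)) (λ ρ → + suc ρ) ⟩
    ∑[ ρ < n ] fun (+ suc ρ) - ∑[ ρ < n ] (+ suc ρ)
      ≡⟨ cong₂ _-_ (sym ∑-map-fun-window) (sym ∑-window) ⟩
    sumℤ (map fun (window n)) - sumℤ (window n)
      ≡⟨ cong (_- sumℤ (window n)) sum-cond ⟩
    sumℤ (window n) - sumℤ (window n)
      ≡⟨ ℤP.+-inverseʳ (sumℤ (window n)) ⟩
    0ℤ ∎
    where
      ∑-window : sumℤ (window n) ≡ ∑[ ρ < n ] (+ suc ρ)
      ∑-window = foldr-map-applyUpTo (λ k → + suc k) (λ k → k) n
      ∑-map-fun-window : sumℤ (map fun (window n)) ≡ ∑[ ρ < n ] fun (+ suc ρ)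
      ∑-map-fun-window = trans (cong sumℤ (sym (List.map-∘ {g = fun} {f = λ k → + suc k} (upTo n))))
                               (foldr-map-applyUpTo (λ k → fun (+ suc k)) (λ k → k) n)

  netCrossings-zero : netCrossings 0ℤ ≡ 0ℤ
  netCrossings-zero = ℤP.*-cancelˡ-≡ (+ n) _ _ (begin
    + n * netCrossings 0ℤ                  ≡⟨ ∑-const n _ ⟨
    ∑[ t < n ] netCrossings 0ℤ             ≡⟨ ∑-cong n (λ t t<n → netCrossings-const (suc t) t<n) ⟨
    ∑[ t < n ] netCrossings (1ℤ + + t)     ≡⟨ netCrossings-average ⟩
    0ℤ                                     ≡⟨ ℤP.*-zeroʳ (+ n) ⟨
    + n * 0ℤ                               ∎)

  -- j ↦ 1 − w j maps the indices crossing the cut after 0 downwards (j ≤ 0 < w j) onto negSet and those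
  -- crossing upwards (w j ≤ 0 < j) onto posSet.
  φ : ℤ → ℤ
  φ j = 1ℤ - fun j

  ψ : ℤ → ℤ
  ψ i = inv (1ℤ - i)

  1-[1-x] : ∀ x → 1ℤ - (1ℤ - x) ≡ x
  1-[1-x] = solve-∀

  φ∘ψ : ∀ i → φ (ψ i) ≡ i
  φ∘ψ i = trans (cong (_-_ 1ℤ) (fun-inv (1ℤ - i))) (1-[1-x] i)

  ψ∘φ : ∀ j → ψ (φ j) ≡ j
  ψ∘φ j = trans (cong inv (1-[1-x] (fun j))) (inv-fun j)

  𝟙-inImg : ∀ i → 𝟙 (inImg? w i) ≡ ⟦ ψ i ≤ 0ℤ ⟧
  𝟙-inImg i = 𝟙-cong (λ (j , j≤0 , φj≡i) → subst (_≤ 0ℤ) (trans (sym (ψ∘φ j)) (cong ψ φj≡i)) j≤0)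
                     (λ ψi≤0 → ψ i , ψi≤0 , φ∘ψ i) (inImg? w i) (ψ i ≤? 0ℤ)

  neg? : ∀ i → Dec (i ≤ 0ℤ × InImg w i)
  neg? i = (i ≤? 0ℤ) ×-dec inImg? w i

  pos? : ∀ i → Dec (0ℤ < i × ¬ InImg w i)
  pos? i = (0ℤ <? i) ×-dec ¬? (inImg? w i)

  𝟙-neg?-pos? : ∀ i → 𝟙 (neg? i) - 𝟙 (pos? i) ≡ crossing 0ℤ (ψ i)
  𝟙-neg?-pos? i = begin
    𝟙 (neg? i) - 𝟙 (pos? i)
      ≡⟨ cong₂ _-_ (trans (𝟙-× (i ≤? 0ℤ) (inImg? w i)) (cong (_*_ ⟦ i ≤ 0ℤ ⟧) (𝟙-inImg i)))
                   (trans (𝟙-× (0ℤ <? i) (¬? (inImg? w i)))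
                          (cong₂ _*_ (𝟙-0< i) (trans (𝟙-¬ (inImg? w i)) (cong (_-_ 1ℤ) (𝟙-inImg i))))) ⟩
    ⟦ i ≤ 0ℤ ⟧ * ⟦ ψ i ≤ 0ℤ ⟧ - (1ℤ - ⟦ i ≤ 0ℤ ⟧) * (1ℤ - ⟦ ψ i ≤ 0ℤ ⟧)
      ≡⟨ lemma ⟦ i ≤ 0ℤ ⟧ ⟦ ψ i ≤ 0ℤ ⟧ ⟩
    ⟦ i ≤ 0ℤ ⟧ + ⟦ ψ i ≤ 0ℤ ⟧ - 1ℤ
      ≡⟨ cong (λ x → ⟦ x ≤ 0ℤ ⟧ + ⟦ ψ i ≤ 0ℤ ⟧ - 1ℤ) (φ∘ψ i) ⟨
    ⟦ 1ℤ - fun (ψ i) ≤ 0ℤ ⟧ + ⟦ ψ i ≤ 0ℤ ⟧ - 1ℤ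
      ≡⟨ cong (λ x → x + ⟦ ψ i ≤ 0ℤ ⟧ - 1ℤ) (trans (⟦1-x≤0⟧ (fun (ψ i))) (𝟙-0< (fun (ψ i)))) ⟩
    (1ℤ - ⟦ fun (ψ i) ≤ 0ℤ ⟧) + ⟦ ψ i ≤ 0ℤ ⟧ - 1ℤ
      ≡⟨ lemma′ ⟦ fun (ψ i) ≤ 0ℤ ⟧ ⟦ ψ i ≤ 0ℤ ⟧ ⟩
    crossing 0ℤ (ψ i) ∎
    where lemma : ∀ a b → a * b - (1ℤ - a) * (1ℤ - b) ≡ a + b - 1ℤ
          lemma = solve-∀
          lemma′ : ∀ c b → (1ℤ - c) + b - 1ℤ ≡ b - c
          lemma′ = solve-∀

  +2D : + (2 ℕ.* D) ≡ + D + + D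
  +2D = trans (cong (λ d → + (D ℕ.+ d)) (ℕP.+-identityʳ D)) (ℤP.pos-+ D D)

  +[1+2D] : + suc (2 ℕ.* D) ≡ 1ℤ + (+ D + + D)
  +[1+2D] = cong (_+_ 1ℤ) +2D

  crossing-far : ∀ j → ¬ φ j ∈[ - + D , - + D + + suc (2 ℕ.* D) ⟩ → crossing 0ℤ j ≡ 0ℤ
  crossing-far j outside with - + D ≤? φ j
  ... | no below = cong₂ _-_
    (𝟙-no (j ≤? 0ℤ) (ℤP.<⇒≱ (nonneg⇒< (p ⊕ proj₁ (fun-displacement j) ⊕ ⟨+ 1 ⟩ by lemma (+ D) (fun j) j))))
    (𝟙-no (fun j ≤? 0ℤ) (ℤP.<⇒≱ (nonneg⇒< (p ⊕ ⟨+ D ⟩ ⊕ ⟨+ 1 ⟩ by lemma′ (+ D) (fun j)))))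
    where p : Nonneg (- + D - φ j - 1ℤ)
          p = <⇒nonneg (ℤP.≰⇒> below)
          lemma : ∀ d f j → - d - (1ℤ - f) - 1ℤ + (d - (f - j)) + 1ℤ ≡ j - 0ℤ - 1ℤ
          lemma = solve-∀
          lemma′ : ∀ d f → - d - (1ℤ - f) - 1ℤ + d + 1ℤ ≡ f - 0ℤ - 1ℤ
          lemma′ = solve-∀
  ... | yes above = cong₂ _-_
    (𝟙-yes (j ≤? 0ℤ) (nonneg⇒≤ (p ⊕ proj₂ (fun-displacement j)
                                by trans (cong (λ l → 1ℤ - fun j - (- + D + l) + (+ D + (fun j - j))) +[1+2D]) (lemma (+ D) (fun j) j))))
    (𝟙-yes (fun j ≤? 0ℤ) (nonneg⇒≤ (p ⊕ ⟨+ D ⟩ by trans (cong (λ l → 1ℤ - fun j - (- + D + l) + + D) +[1+2D]) (lemma′ (+ D) (fun j)))))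
    where p : Nonneg (φ j - (- + D + + suc (2 ℕ.* D)))
          p = ≤⇒nonneg (ℤP.≮⇒≥ (λ below-end → outside (above , below-end)))
          lemma : ∀ d f j → 1ℤ - f - (- d + (1ℤ + (d + d))) + (d + (f - j)) ≡ 0ℤ - j
          lemma = solve-∀
          lemma′ : ∀ d f → 1ℤ - f - (- d + (1ℤ + (d + d))) + d ≡ 0ℤ - f
          lemma′ = solve-∀

  ψ-near : ∀ k → k ℕ.< suc (2 ℕ.* D) → Near (ψ (- + D + + k))
  ψ-near k k≤2D = near {x} {inv x} (≤⇒nonneg (ℤ.+≤+ (ℕP.≤-pred k≤2D)) by trans (cong (_- + k) +2D) (lemma (+ k) (+ D)))
                                   (⟨+ m ⟩ ⊕ ⟨+ k ⟩ by lemma′ (+ m) (+ k) (+ D))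
                                   (inv-displacement x)
    where x : ℤ
          x = 1ℤ - (- + D + + k)
          lemma : ∀ k d → d + d - k ≡ 1ℤ - (- d + k) - 1ℤ + d
          lemma = solve-∀
          lemma′ : ∀ m k d → m + k ≡ (1ℤ + m) + d - (1ℤ - (- d + k))
          lemma′ = solve-∀

  ∑-range : ∀ (f : ℤ → ℤ) → sumℤ (map f (range w)) ≡ ∑[ k < suc (2 ℕ.* D) ] f (+ k - + D)
  ∑-range f = trans (cong sumℤ (sym (List.map-∘ {g = f} {f = λ k → + k - + D} (upTo (suc (2 ℕ.* D))))))
                    (foldr-map-applyUpTo (λ k → f (+ k - + D)) (λ k → k) (suc (2 ℕ.* D)))

  length-negSet≡length-posSet : length (negSet w) ≡ length (posSet w)
  length-negSet≡length-posSet = ℤP.+-injective (ℤP.i-j≡0⇒i≡j (+ length (negSet w)) (+ length (posSet w)) (begin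
    + length (negSet w) - + length (posSet w)
      ≡⟨ cong₂ _-_ (length-filter neg? (range w)) (length-filter pos? (range w)) ⟩
    sumℤ (map (𝟙 ∘ neg?) (range w)) - sumℤ (map (𝟙 ∘ pos?) (range w))
      ≡⟨ cong₂ _-_ (∑-range (𝟙 ∘ neg?)) (∑-range (𝟙 ∘ pos?)) ⟩
    ∑[ k < L ] 𝟙 (neg? (+ k - + D)) - ∑[ k < L ] 𝟙 (pos? (+ k - + D))
      ≡⟨ ∑-distrib-sub L (λ k → 𝟙 (neg? (+ k - + D))) (λ k → 𝟙 (pos? (+ k - + D))) ⟨
    ∑[ k < L ] (𝟙 (neg? (+ k - + D)) - 𝟙 (pos? (+ k - + D)))
      ≡⟨ ∑-cong L {λ k → 𝟙 (neg? (+ k - + D)) - 𝟙 (pos? (+ k - + D))} (λ k _ → pointwise k) ⟩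
    ∑[ k < L ] crossing 0ℤ (ψ (- + D + + k))
      ≡⟨ ∑-reindex {φ} {ψ} φ∘ψ ψ∘φ (crossing 0ℤ) (- + D) L window-start len
                   (λ k k<L → near⇒∈window (ψ-near k k<L)) (λ s _ → crossing-far (window-start + + s)) ⟩
    netCrossings 0ℤ
      ≡⟨ netCrossings-zero ⟩
    0ℤ ∎))
    where L : ℕ
          L = suc (2 ℕ.* D)
          pointwise : ∀ k → 𝟙 (neg? (+ k - + D)) - 𝟙 (pos? (+ k - + D)) ≡ crossing 0ℤ (ψ (- + D + + k))
          pointwise k = trans (𝟙-neg?-pos? (+ k - + D)) (cong (λ i → crossing 0ℤ (ψ i)) (ℤP.+-comm (+ k) (- + D)))

module Polynomial {c ℓ} (R : CommutativeRing c ℓ) where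
  open CommutativeRing R
  open FiniteSum R
  open import Relation.Binary.Reasoning.Setoid setoid
  open import Algebra.Solver.Ring.NaturalCoefficients.Default commutativeSemiring using (solve; _:=_; _:+_; _:*_; con)
  open import Algebra.Properties.Group +-group using (//-rightDividesˡ; //-rightDividesʳ)
  open import Algebra.Properties.CommutativeSemigroup *-commutativeSemigroup using (x∙yz≈y∙xz)

  sgn : ℕ → Carrier
  sgn zero    = 1#
  sgn (suc j) = - sgn j

  esym : ℕ → List Carrier → Carrier
  esym zero    _        = 1#
  esym (suc j) []       = 0#
  esym (suc j) (b ∷ bs) = b * esym j bs + esym (suc j) bs

  coeff : List Carrier → ℕ → Carrier
  coeff bs j = sgn j * esym j bs

  ∏-sub : List Carrier → Carrier → Carrier
  ∏-sub []       x = 1#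
  ∏-sub (b ∷ bs) x = (x - b) * ∏-sub bs x

  horner : (ℕ → Carrier) → ℕ → Carrier → Carrier
  horner g zero    x = 0#
  horner g (suc k) x = x * horner g k x + g k

  esym-vanishes : ∀ bs k → esym (suc k ℕ.+ length bs) bs ≈ 0#
  esym-vanishes []       k = refl
  esym-vanishes (b ∷ bs) k = begin
    b * esym (k ℕ.+ suc (length bs)) bs + esym (suc k ℕ.+ suc (length bs)) bs
      ≡⟨ ≡.cong₂ (λ i j → b * esym i bs + esym j bs) (ℕP.+-suc k (length bs)) (ℕP.+-suc (suc k) (length bs)) ⟩
    b * esym (suc k ℕ.+ length bs) bs + esym (suc (suc k) ℕ.+ length bs) bs
      ≈⟨ +-cong (*-congˡ (esym-vanishes bs k)) (esym-vanishes bs (suc k)) ⟩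
    b * 0# + 0#
      ≈⟨ trans (+-identityʳ _) (zeroʳ b) ⟩
    0# ∎

  -- With y = x - b and t = - s this is a semiring identity up to the term b e (s + t) ≈ 0.
  horner-step : ∀ x b h s e e′ → x * ((x - b) * h + s * e) + (- s) * (b * e + e′)
                                   ≈ (x - b) * (x * h + s * e) + (- s) * e′
  horner-step x b h s e e′ = begin
    x * (y * h + s * e) + t * (b * e + e′)                 ≈⟨ +-congʳ (*-congʳ (sym (//-rightDividesˡ b x))) ⟩
    (y + b) * (y * h + s * e) + t * (b * e + e′)           ≈⟨ solve 7 (λ y b h s t e e′ → (y :+ b) :* (y :* h :+ s :* e) :+ t :* (b :* e :+ e′)
                                                                  := (y :* ((y :+ b) :* h :+ s :* e) :+ t :* e′) :+ b :* e :* (s :+ t)) refl y b h s t e e′ ⟩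
    (y * ((y + b) * h + s * e) + t * e′) + b * e * (s + t) ≈⟨ +-congˡ (trans (*-congˡ (-‿inverseʳ s)) (zeroʳ _)) ⟩
    (y * ((y + b) * h + s * e) + t * e′) + 0#              ≈⟨ +-identityʳ _ ⟩
    y * ((y + b) * h + s * e) + t * e′                     ≈⟨ +-congʳ (*-congˡ (+-congʳ (*-congʳ (//-rightDividesˡ b x)))) ⟩
    y * (x * h + s * e) + t * e′                           ∎
    where y t : Carrier
          y = x - b
          t = - s

  horner-coeff-∷ : ∀ b bs x k → horner (coeff (b ∷ bs)) (suc k) x ≈ (x - b) * horner (coeff bs) k x + coeff bs k
  horner-coeff-∷ b bs x zero    = +-congʳ (trans (zeroʳ x) (sym (zeroʳ (x - b))))
  horner-coeff-∷ b bs x (suc k) = trans (+-congʳ (*-congˡ (horner-coeff-∷ b bs x k)))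
                                        (horner-step x b (horner (coeff bs) k x) (sgn k) (esym k bs) (esym (suc k) bs))

  horner-coeff≈∏-sub : ∀ bs x → horner (coeff bs) (suc (length bs)) x ≈ ∏-sub bs x
  horner-coeff≈∏-sub []       x = trans (+-congʳ (zeroʳ x)) (trans (+-identityˡ _) (*-identityˡ 1#))
  horner-coeff≈∏-sub (b ∷ bs) x = begin
    horner (coeff (b ∷ bs)) (suc (suc (length bs))) x
      ≈⟨ horner-coeff-∷ b bs x (suc (length bs)) ⟩
    (x - b) * horner (coeff bs) (suc (length bs)) x + sgn (suc (length bs)) * esym (suc (length bs)) bs
      ≈⟨ +-cong (*-congˡ (horner-coeff≈∏-sub bs x)) (trans (*-congˡ (esym-vanishes bs 0)) (zeroʳ _)) ⟩
    (x - b) * ∏-sub bs x + 0#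
      ≈⟨ +-identityʳ _ ⟩
    ∏-sub (b ∷ bs) x ∎

  ∑-pow≈x*horner : ∀ g r x → ∑[ i < r ] (g (r ℕ.∸ suc i) * powR R x (suc i)) ≈ x * horner g r x
  ∑-pow≈x*horner g zero    x = sym (zeroʳ x)
  ∑-pow≈x*horner g (suc r) x = begin
    g r * (x * 1#) + ∑[ i < r ] (g (r ℕ.∸ suc i) * (x * powR R x (suc i)))
      ≈⟨ +-congˡ (∑-cong r (λ i _ → x∙yz≈y∙xz (g (r ℕ.∸ suc i)) x (powR R x (suc i)))) ⟩
    g r * (x * 1#) + ∑[ i < r ] (x * (g (r ℕ.∸ suc i) * powR R x (suc i)))
      ≈⟨ +-congˡ (trans (∑-distribˡ-* r x _) (*-congˡ (∑-pow≈x*horner g r x))) ⟩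
    g r * (x * 1#) + x * (x * horner g r x)
      ≈⟨ solve 3 (λ a x h → a :* (x :* con 1) :+ x :* (x :* h) := x :* (x :* h :+ a)) refl (g r) x (horner g r x) ⟩
    x * horner g (suc r) x ∎

  ∑-coeff-pow : ∀ {r} bs x → length bs ≡.≡ r →
                ∑[ i < r ] (coeff bs (r ℕ.∸ suc i) * powR R x (suc i)) ≈ ∏-sub bs x - coeff bs r
  ∑-coeff-pow bs x ≡.refl = begin
    ∑[ i < r ] (g (r ℕ.∸ suc i) * powR R x (suc i))    ≈⟨ ∑-pow≈x*horner g r x ⟩
    x * horner g r x                                   ≈⟨ sym (//-rightDividesʳ (g r) (x * horner g r x)) ⟩
    horner g (suc r) x - g r                           ≈⟨ +-congʳ (horner-coeff≈∏-sub bs x) ⟩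
    ∏-sub bs x - g r                                   ∎
    where r : ℕ
          r = length bs
          g : ℕ → Carrier
          g = coeff bs

  ∏-sub-root : ∀ {x} bs → Any (x ≈_) bs → ∏-sub bs x ≈ 0#
  ∏-sub-root (b ∷ bs) (here x≈b)   = trans (*-congʳ (trans (+-congʳ x≈b) (-‿inverseʳ b))) (zeroˡ _)
  ∏-sub-root (b ∷ bs) (there root) = trans (*-congˡ (∏-sub-root bs root)) (zeroʳ _)

module Evaluation {c ℓ} (R : CommutativeRing c ℓ) {n} (w : AffPerm n) (α : ℤ → CommutativeRing.Carrier R) where
  open CommutativeRing R
  open FiniteSum R
  open Polynomial R
  open import Relation.Binary.Reasoning.Setoid setoid
  open import Algebra.Properties.Ring ring using (x[y-z]≈xy-xz)

  ev : Λexpr → Carrier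
  ev = εeval R w α

  ev-signᵉ : ∀ j → ev (signᵉ j) ≡.≡ sgn j
  ev-signᵉ zero    = ≡.refl
  ev-signᵉ (suc j) = ≡.cong -_ (ev-signᵉ j)

  ev-eᵉ : ∀ j es → ev (eᵉ j es) ≡.≡ esym j (map ev es)
  ev-eᵉ zero    es       = ≡.refl
  ev-eᵉ (suc j) []       = ≡.refl
  ev-eᵉ (suc j) (e ∷ es) = ≡.cong₂ (λ a b → ev e * a + b) (ev-eᵉ j es) (ev-eᵉ (suc j) es)

  ev-sumᵉ : ∀ es → ev (sumᵉ es) ≡.≡ foldr _+_ 0# (map ev es)
  ev-sumᵉ []       = ≡.refl
  ev-sumᵉ (e ∷ es) = ≡.cong (_+_ (ev e)) (ev-sumᵉ es)

  roots : ℕ → List Carrier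
  roots r = map ev (avars r)

  length-roots : ∀ r → length (roots r) ≡.≡ r
  length-roots r = ≡.trans (List.length-map ev (avars r)) (≡.trans (List.length-map _ (upTo r)) (List.length-upTo r))

  ev-m̃ : ∀ r → ev (m̃ r) ≈ ∑[ k < r ] (coeff (roots r) (r ℕ.∸ suc k) * εp R w α (suc k))
  ev-m̃ r = begin
    ev (m̃ r)
      ≡⟨ ≡.trans (ev-sumᵉ (map T (upTo r))) (≡.cong (foldr _+_ 0#) (≡.sym (List.map-∘ (upTo r)))) ⟩
    foldr _+_ 0# (map (ev ∘ T) (upTo r))
      ≈⟨ foldr-map-applyUpTo (ev ∘ T) (λ k → k) r ⟩
    ∑[ k < r ] ev (T k)
      ≈⟨ ∑-cong r (λ k _ → reflexive (≡.cong₂ (λ s e → s * e * εp R w α (suc k))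
                                               (ev-signᵉ (r ℕ.∸ suc k)) (ev-eᵉ (r ℕ.∸ suc k) (avars r)))) ⟩
    ∑[ k < r ] (coeff (roots r) (r ℕ.∸ suc k) * εp R w α (suc k)) ∎
    where T : ℕ → Λexpr
          T k = (signᵉ (r ℕ.∸ suc k) *ᵉ eᵉ (r ℕ.∸ suc k) (avars r)) *ᵉ pᵉ (suc k)

  εeval-m̃≈0 : ∀ r → length (negSet w) ≡.≡ length (posSet w) → (∀ i → Any (α i ≈_) (roots r)) → ev (m̃ r) ≈ 0#
  εeval-m̃≈0 r balanced rooted = begin
    ev (m̃ r)
      ≈⟨ ev-m̃ r ⟩
    ∑[ k < r ] (g k * (Σ (negSet w) (suc k) - Σ (posSet w) (suc k)))
      ≈⟨ trans (∑-cong r (λ k _ → x[y-z]≈xy-xz (g k) _ _)) (∑-distrib-sub r _ _) ⟩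
    ∑[ k < r ] (g k * Σ (negSet w) (suc k)) - ∑[ k < r ] (g k * Σ (posSet w) (suc k))
      ≈⟨ +-cong (exchange (negSet w)) (-‿cong (exchange (posSet w))) ⟩
    foldr _+_ 0# (map F (negSet w)) - foldr _+_ 0# (map F (posSet w))
      ≈⟨ +-cong (foldr-map-cong F-const (negSet w)) (-‿cong (foldr-map-cong F-const (posSet w))) ⟩
    foldr _+_ 0# (map (λ _ → F₀) (negSet w)) - foldr _+_ 0# (map (λ _ → F₀) (posSet w))
      ≈⟨ +-congʳ (foldr-map-const F₀ (negSet w) (posSet w) balanced) ⟩
    foldr _+_ 0# (map (λ _ → F₀) (posSet w)) - foldr _+_ 0# (map (λ _ → F₀) (posSet w))
      ≈⟨ -‿inverseʳ _ ⟩
    0# ∎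
    where
      B : List Carrier
      B = roots r
      g : ℕ → Carrier
      g k = coeff B (r ℕ.∸ suc k)
      F₀ : Carrier
      F₀ = 0# - coeff B r
      Σ : List ℤ → ℕ → Carrier
      Σ is j = foldr _+_ 0# (map (λ i → powR R (α i) j) is)
      F : ℤ → Carrier
      F i = ∑[ k < r ] (g k * powR R (α i) (suc k))
      exchange : ∀ is → ∑[ k < r ] (g k * Σ is (suc k)) ≈ foldr _+_ 0# (map F is)
      exchange is = trans (∑-cong r (λ k _ → *-distribˡ-foldr (g k) _ is)) (foldr-map-∑ r _ is)
      F-const : ∀ i → F i ≈ F₀
      F-const i = trans (∑-coeff-pow B (α i) (length-roots r)) (+-congʳ (∏-sub-root B (rooted i)))

  periodic⇒rooted : ∀ r → n ℕ.≤ r → {{_ : ℕ.NonZero n}} → (∀ i → α (i ℤ.+ + n) ≈ α i) → ∀ i → Any (α i ≈_) (roots r)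
  periodic⇒rooted r n≤r per i = ≡.subst (Any (α i ≈_)) roots≡
    (Any.applyUpTo⁺ (λ k → α (1ℤ ℤ.- + k)) α[i]≈α[1-k] (ℕP.<-≤-trans (n%ℕd<d (1ℤ ℤ.- i) n) n≤r))
    where
      roots≡ : applyUpTo (λ k → α (1ℤ ℤ.- + k)) r ≡.≡ roots r
      roots≡ = ≡.trans (≡.sym (List.map-upTo (λ k → α (1ℤ ℤ.- + k)) r)) (List.map-∘ (upTo r))
      k : ℕ
      k = (1ℤ ℤ.- i) %ℕ n
      q : ℤ
      q = (1ℤ ℤ.- i) /ℕ n
      i≡ : (1ℤ ℤ.- + k) ℤ.+ (ℤ.- q) ℤ.* + n ≡.≡ i
      i≡ = ≡.trans (lemma (+ k) q (+ n)) (≡.trans (≡.cong (ℤ._-_ 1ℤ) (≡.sym (a≡a%ℕn+[a/ℕn]*n (1ℤ ℤ.- i) n))) (lemma′ i))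
        where lemma : ∀ k q n → (1ℤ ℤ.- k) ℤ.+ (ℤ.- q) ℤ.* n ≡.≡ 1ℤ ℤ.- (k ℤ.+ q ℤ.* n)
              lemma = solve-∀
              lemma′ : ∀ i → 1ℤ ℤ.- (1ℤ ℤ.- i) ≡.≡ i
              lemma′ = solve-∀
      α[i]≈α[1-k] : α i ≈ α (1ℤ ℤ.- + k)
      α[i]≈α[1-k] = trans (reflexive (≡.cong α (≡.sym i≡))) (periodic-* setoid n α per (1ℤ ℤ.- + k) (ℤ.- q))

open import Data.Nat using (_≤_)
open import Data.Integer using (_+_)

lemma4p3 : (n : ℕ) → 2 ≤ n → (r : ℕ) → n ≤ r → (w : AffPerm n)
    → ∀ {c ℓ} (R : CommutativeRing c ℓ) (α : ℤ → CommutativeRing.Carrier R)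
    → (∀ i → CommutativeRing._≈_ R (α (i + + n)) (α i))
    → CommutativeRing._≈_ R (εeval R w α (m̃ r)) (CommutativeRing.0# R)
lemma4p3 (suc (suc k)) _ r n≤r w R α periodic =
  εeval-m̃≈0 r (length-negSet≡length-posSet w) (periodic⇒rooted r n≤r periodic)
  where open Evaluation R w α
        open Crossings using (length-negSet≡length-posSet)
lemma4p3 (suc zero) (s≤s ()) _ _ _ _ _ _
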